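{- Let $G$ be a 2-connected cubic graph in which every vertex belongs to exactly one triangle. Let $E\subset E(G)$ with $|E|=2$. Then $G-E$ (the graph obtained from $G$ by deleting the edges of $E$) has a $\Lambda$-factor.
   Context: Graphs are finite, simple, undirected. Cubic: every vertex has degree 3. A $\Lambda$-factor of $H$ is a spanning subgraph of $H$ each component of which is a 3-vertex path. -}

module Defs where

open import Data.Nat using (ℕ; zero; suc; _≤_)
open import Data.Fin using (Fin)
open import Data.Bool using (Bool; true; false; _∧_; not; T)
open import Data.List using (List; []; _∷_; length; filter)
open import Data.List.Base using ()
open import Data.Fin.Base using ()
open import Data.Product using (Σ; ∃; ∃-syntax; _×_; _,_)
open import Data.Sum using (_⊎_)
open import Relation.Nullary using (¬_)
open import Relation.Binary.PropositionalEquality using (_≡_; _≢_; refl; cong)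
open import Data.Empty using (⊥)
open import Data.Bool using (_∨_)
open import Data.Bool.Properties using (T?; ∧-comm; ∨-comm)
open import Data.List.Base using (List)
open import Data.Vec.Functional using ()
open import Data.Fin.Properties using ()
open import Relation.Nullary.Decidable using (does)
import Data.List as L
import Data.Fin as F

record Graph (n : ℕ) : Set where
  field
    adj   : Fin n → Fin n → Bool
    sym   : ∀ u v → adj u v ≡ adj v u
    irrefl : ∀ v → adj v v ≡ false
open Graph public

Adj : ∀ {n} → Graph n → Fin n → Fin n → Set
Adj G u v = T (adj G u v)

degree : ∀ {n} → Graph n → Fin n → ℕ
degree {n} G v = length (filter (λ w → T? (adj G v w)) (L.allFin n))

Cubic : ∀ {n} → Graph n → Set
Cubic {n} G = ∀ v → degree G v ≡ 3

-- Triangle: three pairwise adjacent vertices (adjacency implies distinctness).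
Triangle : ∀ {n} → Graph n → Fin n → Fin n → Fin n → Set
Triangle G a b c = Adj G a b × Adj G b c × Adj G a c

InExactlyOneTriangle : ∀ {n} → Graph n → Fin n → Set
InExactlyOneTriangle G v =
  ∃[ a ] ∃[ b ] (Triangle G v a b ×
    (∀ x y → Triangle G v x y → (x ≡ a × y ≡ b) ⊎ (x ≡ b × y ≡ a)))

data WalkAvoid {n} (G : Graph n) (R : Fin n → Set) : Fin n → Fin n → Set where
  here : ∀ {u} → ¬ R u → WalkAvoid G R u u
  step : ∀ {u v w} → ¬ R u → Adj G u v → WalkAvoid G R v w → WalkAvoid G R u w


Connected : ∀ {n} → Graph n → Set
Connected {n} G = ∀ (u v : Fin n) → WalkAvoid G (λ _ → ⊥) u v

TwoConnected : ∀ {n} → Graph n → Set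
TwoConnected {n} G =
  3 ≤ n × Connected G ×
  (∀ (x u v : Fin n) → u ≢ x → v ≢ x → WalkAvoid G (λ w → w ≡ x) u v)

isEdge : ∀ {n} → Fin n → Fin n → Fin n → Fin n → Bool
isEdge a b u v = (does (u F.≟ a) ∧ does (v F.≟ b)) ∨ (does (u F.≟ b) ∧ does (v F.≟ a))

deleteTwo : ∀ {n} → Graph n → Fin n → Fin n → Fin n → Fin n → Graph n
deleteTwo G a b c d = record
  { adj = λ u v → adj G u v ∧ not (isEdge a b u v) ∧ not (isEdge c d u v)
  ; sym = λ u v → prf u v
  ; irrefl = λ v → cong (λ z → z ∧ _) (irrefl G v) }
  where
  isEdge-sym : ∀ {n} (a b u v : Fin n) → isEdge a b u v ≡ isEdge a b v u
  isEdge-sym a b u v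
    with u F.≟ a | v F.≟ b | u F.≟ b | v F.≟ a
  ... | x1 | x2 | x3 | x4 = lemma (does x1) (does x2) (does x3) (does x4)
    where
    lemma : ∀ p q r s → (p ∧ q) ∨ (r ∧ s) ≡ (s ∧ r) ∨ (q ∧ p)
    lemma p q r s rewrite ∧-comm p q | ∧-comm r s = ∨-comm (q ∧ p) (s ∧ r)
  prf : ∀ u v → (adj G u v ∧ not (isEdge a b u v) ∧ not (isEdge c d u v)) ≡ (adj G v u ∧ not (isEdge a b v u) ∧ not (isEdge c d v u))
  prf u v rewrite sym G u v | isEdge-sym a b u v | isEdge-sym c d u v = refl

Subgraph : ∀ {n} → Graph n → Graph n → Set
Subgraph F H = ∀ u v → Adj F u v → Adj H u v

ΛFactor : ∀ {n} → Graph n → Set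
ΛFactor {n} H = Σ (Graph n) λ F → Subgraph F H ×
  (∀ v → ∃[ a ] ∃[ c ] ∃[ b ]
     (a ≢ c × c ≢ b × a ≢ b ×
      (∀ w → WalkAvoid F (λ _ → ⊥) v w → (w ≡ a ⊎ w ≡ c ⊎ w ≡ b)) ×
      WalkAvoid F (λ _ → ⊥) v a × WalkAvoid F (λ _ → ⊥) v c × WalkAvoid F (λ _ → ⊥) v b ×
      Adj F a c × Adj F c b × ¬ Adj F a b))

module Submission where

open import Defs
open import Data.Nat using (ℕ)
open import Data.Fin using (Fin; _<_)
open import Data.Fin.Properties using (_≟_; _<?_; <-cmp; <-trans; <-asym; any?)
open import Data.Bool using (Bool; T; _∧_)
open import Data.Bool.Properties using (T?; ∧-comm; T-∧; T-∨)
open import Data.List using (List; []; _∷_; length; filter; allFin)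
open import Data.List.Membership.Propositional using (_∈_; find; lose)
open import Data.List.Membership.Propositional.Properties using (∈-filter⁺; ∈-filter⁻; ∈-allFin)
open import Data.List.Relation.Unary.Any as Any using (Any; here; there)
open import Data.List.Relation.Unary.All as All using (All; []; _∷_)
open import Data.List.Relation.Unary.All.Properties using (¬Any⇒All¬)
open import Data.List.Relation.Unary.AllPairs using (AllPairs; []; _∷_)
open import Data.List.Relation.Unary.Unique.Propositional using (Unique)
import Data.List.Relation.Unary.Unique.Propositional.Properties as Unique
open import Data.Product using (Σ; ∃-syntax; _×_; _,_; proj₁; proj₂)
open import Data.Sum using (_⊎_; inj₁; inj₂; [_,_]′)
import Data.Sum as Sum
open import Data.Empty using (⊥; ⊥-elim)
open import Function.Base using (id)
open import Function.Bundles using (Equivalence)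
open import Relation.Nullary using (¬_; Dec; yes; no; ¬?; _×-dec_; _⊎-dec_)
open import Relation.Nullary.Decidable using (does; isYes; toWitness; fromWitness; dec-no)
open import Relation.Binary.Definitions using (tri<; tri≈; tri>)
open import Relation.Binary.PropositionalEquality using (_≡_; _≢_; refl; cong; subst; ≢-sym)
import Relation.Binary.PropositionalEquality as ≡

-- The triangles partition V(G): each vertex v has two mates and one outside
-- neighbour out v.  A Λ-factor is assembled from two kinds of pieces:
--   * a triangle that keeps two of its edges in H gives the path along them,
--     centred at the corner opposite the missing edge (its least corner if
--     no edge is missing);
--   * a cycle of distinct triangles, each entered at p and left at a mate q,
--     gives the paths  out p – p – r  (r the third corner) covering it.
-- ΛConstruction turns any triangle cycle compatible with H into a Λ-factor
-- (ΛFactorFromBlocks: every vertex lies in a closed 3-vertex path of a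
-- spanning subgraph).  If no triangle loses two edges the empty cycle works.
-- Otherwise both deleted edges meet at a corner z of one triangle; by
-- 2-connectivity some walk from out z to a mate of z avoids z, and its loop
-- erasure (TriangleChains) closes into a cycle of triangles leaving z's
-- triangle at z, which is compatible with H.

OneOf : ∀ {A : Set} → A → A → A → A → Set
OneOf a c b x = x ≡ a ⊎ x ≡ c ⊎ x ≡ b

thirdEntry : ∀ {A : Set} (xs : List A) → length xs ≡ 3 → Unique xs →
  ∀ {a b} → a ∈ xs → b ∈ xs → a ≢ b →
  Σ A λ o → o ∈ xs × o ≢ a × o ≢ b × (∀ {w} → w ∈ xs → OneOf a b o w)
thirdEntry {A} (x₁ ∷ x₂ ∷ x₃ ∷ []) refl ((x₁≢x₂ ∷ x₁≢x₃ ∷ []) ∷ (x₂≢x₃ ∷ []) ∷ [] ∷ []) =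
  λ a∈ b∈ a≢b → choose (position a∈) (position b∈) a≢b
  where
  xs : List A
  xs = x₁ ∷ x₂ ∷ x₃ ∷ []

  Entry : A → Set
  Entry w = OneOf x₁ x₂ x₃ w

  position : ∀ {w} → w ∈ xs → Entry w
  position (here w≡x₁) = inj₁ w≡x₁
  position (there (here w≡x₂)) = inj₂ (inj₁ w≡x₂)
  position (there (there (here w≡x₃))) = inj₂ (inj₂ w≡x₃)

  Result : A → A → Set
  Result a b = Σ A λ o → o ∈ xs × o ≢ a × o ≢ b × (∀ {w} → w ∈ xs → OneOf a b o w)

  rearrange : ∀ {a b o} → (∀ {w} → Entry w → OneOf a b o w) → ∀ {w} → w ∈ xs → OneOf a b o w
  rearrange σ w∈ = σ (position w∈)

  choose : ∀ {a b} → Entry a → Entry b → a ≢ b → Result a b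
  choose (inj₁ refl) (inj₁ refl) a≢b = ⊥-elim (a≢b refl)
  choose (inj₂ (inj₁ refl)) (inj₂ (inj₁ refl)) a≢b = ⊥-elim (a≢b refl)
  choose (inj₂ (inj₂ refl)) (inj₂ (inj₂ refl)) a≢b = ⊥-elim (a≢b refl)
  choose (inj₁ refl) (inj₂ (inj₁ refl)) _ =
    x₃ , there (there (here refl)) , ≢-sym x₁≢x₃ , ≢-sym x₂≢x₃ ,
    rearrange [ inj₁ , [ (λ e → inj₂ (inj₁ e)) , (λ e → inj₂ (inj₂ e)) ]′ ]′
  choose (inj₂ (inj₁ refl)) (inj₁ refl) _ =
    x₃ , there (there (here refl)) , ≢-sym x₂≢x₃ , ≢-sym x₁≢x₃ ,
    rearrange [ (λ e → inj₂ (inj₁ e)) , [ inj₁ , (λ e → inj₂ (inj₂ e)) ]′ ]′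
  choose (inj₁ refl) (inj₂ (inj₂ refl)) _ =
    x₂ , there (here refl) , ≢-sym x₁≢x₂ , x₂≢x₃ ,
    rearrange [ inj₁ , [ (λ e → inj₂ (inj₂ e)) , (λ e → inj₂ (inj₁ e)) ]′ ]′
  choose (inj₂ (inj₂ refl)) (inj₁ refl) _ =
    x₂ , there (here refl) , x₂≢x₃ , ≢-sym x₁≢x₂ ,
    rearrange [ (λ e → inj₂ (inj₁ e)) , [ (λ e → inj₂ (inj₂ e)) , inj₁ ]′ ]′
  choose (inj₂ (inj₁ refl)) (inj₂ (inj₂ refl)) _ =
    x₁ , here refl , x₁≢x₂ , x₁≢x₃ ,
    rearrange [ (λ e → inj₂ (inj₂ e)) , [ inj₁ , (λ e → inj₂ (inj₁ e)) ]′ ]′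
  choose (inj₂ (inj₂ refl)) (inj₂ (inj₁ refl)) _ =
    x₁ , here refl , x₁≢x₃ , x₁≢x₂ ,
    rearrange [ (λ e → inj₂ (inj₂ e)) , [ (λ e → inj₂ (inj₁ e)) , inj₁ ]′ ]′

allPairs-lookup : ∀ {A : Set} {R : A → A → Set} {xs : List A} {x y} →
  AllPairs R xs → x ∈ xs → y ∈ xs → x ≡ y ⊎ R x y ⊎ R y x
allPairs-lookup (_ ∷ _) (here refl) (here refl) = inj₁ refl
allPairs-lookup (rs ∷ _) (here refl) (there y∈) = inj₂ (inj₁ (All.lookup rs y∈))
allPairs-lookup (rs ∷ _) (there x∈) (here refl) = inj₂ (inj₂ (All.lookup rs x∈))
allPairs-lookup (_ ∷ rss) (there x∈) (there y∈) = allPairs-lookup rss x∈ y∈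

leastOfThree : ∀ {n} {x y z : Fin n} → x ≢ y → y ≢ z → x ≢ z →
  (x < y × x < z) ⊎ (y < x × y < z) ⊎ (z < x × z < y)
leastOfThree {x = x} {y} {z} x≢y y≢z x≢z with <-cmp x y | <-cmp y z | <-cmp x z
... | tri≈ _ x≡y _ | _ | _ = ⊥-elim (x≢y x≡y)
... | _ | tri≈ _ y≡z _ | _ = ⊥-elim (y≢z y≡z)
... | _ | _ | tri≈ _ x≡z _ = ⊥-elim (x≢z x≡z)
... | tri< x<y _ _ | _ | tri< x<z _ _ = inj₁ (x<y , x<z)
... | tri< x<y _ _ | _ | tri> _ _ z<x = inj₂ (inj₂ (z<x , <-trans z<x x<y))
... | tri> _ _ y<x | tri< y<z _ _ | _ = inj₂ (inj₁ (y<x , y<z))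
... | tri> _ _ y<x | tri> _ _ z<y | _ = inj₂ (inj₂ (<-trans z<y y<x , z<y))

symmetricCore : ∀ {n} (R : Fin n → Fin n → Set) → (∀ u w → Dec (R u w)) →
  (∀ v → ¬ R v v) → Graph n
symmetricCore R R? irr = record
  { adj = λ u w → isYes (R? u w) ∧ isYes (R? w u)
  ; sym = λ u w → ∧-comm (isYes (R? u w)) (isYes (R? w u))
  ; irrefl = λ v → cong (_∧ isYes (R? v v)) (cong isYes (dec-no (R? v v) (irr v)))
  }

module _ {n} (R : Fin n → Fin n → Set) (R? : ∀ u w → Dec (R u w)) (irr : ∀ v → ¬ R v v) where

  coreAdj⁻ : ∀ {u w} → Adj (symmetricCore R R? irr) u w → R u w × R w u
  coreAdj⁻ {u} {w} uw with Equivalence.to (T-∧ {isYes (R? u w)}) uw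
  ... | r , r′ = toWitness {a? = R? u w} r , toWitness {a? = R? w u} r′

  coreAdj⁺ : ∀ {u w} → R u w → R w u → Adj (symmetricCore R R? irr) u w
  coreAdj⁺ {u} {w} r r′ =
    Equivalence.from (T-∧ {isYes (R? u w)})
                     (fromWitness {a? = R? u w} r , fromWitness {a? = R? w u} r′)

record ΛBlock {n} (F : Graph n) (v : Fin n) : Set where
  constructor mkΛBlock
  field
    left centre right : Fin n
    left≢centre : left ≢ centre
    centre≢right : centre ≢ right
    left≢right : left ≢ right
    contains : OneOf left centre right v
    leftEdge : Adj F left centre
    rightEdge : Adj F centre right
    noChord : ¬ Adj F left right
    closed : ∀ {x y} → OneOf left centre right x → Adj F x y → OneOf left centre right y

ΛFactorFromBlocks : ∀ {n} (H F : Graph n) → Subgraph F H → (∀ v → ΛBlock F v) → ΛFactor H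
ΛFactorFromBlocks {n} H F F⊆H block = F , F⊆H , λ v → component v (block v)
  where
  Walk : Fin n → Fin n → Set
  Walk = WalkAvoid F (λ _ → ⊥)

  flip : ∀ {x y} → Adj F x y → Adj F y x
  flip {x} {y} = subst T (Graph.sym F x y)

  edge : ∀ {x y} → Adj F x y → Walk x y
  edge e = step (λ ()) e (here (λ ()))

  component : ∀ v → ΛBlock F v → ∃[ a ] ∃[ c ] ∃[ b ]
    (a ≢ c × c ≢ b × a ≢ b × (∀ w → Walk v w → OneOf a c b w) ×
     Walk v a × Walk v c × Walk v b × Adj F a c × Adj F c b × ¬ Adj F a b)
  component v (mkΛBlock a c b a≢c c≢b a≢b v∈ ac cb ¬ab closed) =
    a , c , b , a≢c , c≢b , a≢b , (λ w W → stays W v∈) ,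
    toLeft v∈ , toCentre v∈ , toRight v∈ , ac , cb , ¬ab
    where
    stays : ∀ {x w} → Walk x w → OneOf a c b x → OneOf a c b w
    stays (here _) x∈ = x∈
    stays (step _ xy W) x∈ = stays W (closed x∈ xy)

    toLeft : OneOf a c b v → Walk v a
    toLeft (inj₁ refl) = here (λ ())
    toLeft (inj₂ (inj₁ refl)) = edge (flip ac)
    toLeft (inj₂ (inj₂ refl)) = step (λ ()) (flip cb) (edge (flip ac))

    toCentre : OneOf a c b v → Walk v c
    toCentre (inj₁ refl) = edge ac
    toCentre (inj₂ (inj₁ refl)) = here (λ ())
    toCentre (inj₂ (inj₂ refl)) = edge (flip cb)

    toRight : OneOf a c b v → Walk v b
    toRight (inj₁ refl) = step (λ ()) ac (edge cb)
    toRight (inj₂ (inj₁ refl)) = edge cb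
    toRight (inj₂ (inj₂ refl)) = here (λ ())

does-witness : ∀ {A : Set} (d : Dec A) → T (does d) → A
does-witness (yes a) _ = a
does-witness (no _) ()

SameEdge : ∀ {n} → Fin n → Fin n → Fin n → Fin n → Set
SameEdge u w x y = (u ≡ x × w ≡ y) ⊎ (u ≡ y × w ≡ x)

isEdge⁻ : ∀ {n} {x y u w : Fin n} → T (isEdge x y u w) → SameEdge u w x y
isEdge⁻ {x = x} {y} {u} {w} uw =
  Sum.map (both (u ≟ x) (w ≟ y)) (both (u ≟ y) (w ≟ x))
          (Equivalence.to (T-∨ {does (u ≟ x) ∧ does (w ≟ y)}) uw)
  where
  both : ∀ {A B : Set} (a? : Dec A) (b? : Dec B) → T (does a? ∧ does b?) → A × B
  both a? b? ab with Equivalence.to (T-∧ {does a?}) ab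
  ... | ta , tb = does-witness a? ta , does-witness b? tb

sameEdge-trans : ∀ {n} {u w x y p q : Fin n} →
  SameEdge u w x y → SameEdge p q x y → SameEdge u w p q
sameEdge-trans (inj₁ (refl , refl)) (inj₁ (refl , refl)) = inj₁ (refl , refl)
sameEdge-trans (inj₁ (refl , refl)) (inj₂ (refl , refl)) = inj₂ (refl , refl)
sameEdge-trans (inj₂ (refl , refl)) (inj₁ (refl , refl)) = inj₂ (refl , refl)
sameEdge-trans (inj₂ (refl , refl)) (inj₂ (refl , refl)) = inj₁ (refl , refl)

sameEdge-other : ∀ {n} {u y t p q : Fin n} → u ≢ y → SameEdge u y p q → SameEdge u t p q → y ≡ t
sameEdge-other _ (inj₁ (refl , refl)) (inj₁ (_ , refl)) = refl
sameEdge-other _ (inj₂ (refl , refl)) (inj₂ (_ , refl)) = refl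
sameEdge-other u≢y (inj₁ (refl , refl)) (inj₂ (u≡y , _)) = ⊥-elim (u≢y u≡y)
sameEdge-other u≢y (inj₂ (refl , refl)) (inj₁ (u≡y , _)) = ⊥-elim (u≢y u≡y)


module TriangleStructure {n : ℕ} (G : Graph n) (cubic : Cubic G)
                         (tri : ∀ v → InExactlyOneTriangle G v) where

  adj-sym : ∀ {u w} → Adj G u w → Adj G w u
  adj-sym {u} {w} = subst T (Graph.sym G u w)

  adj⇒≢ : ∀ {u w} → Adj G u w → u ≢ w
  adj⇒≢ {u} uw refl = subst T (Graph.irrefl G u) uw

  mate₁ mate₂ : Fin n → Fin n
  mate₁ v = proj₁ (tri v)
  mate₂ v = proj₁ (proj₂ (tri v))

  triangleOf : ∀ v → Triangle G v (mate₁ v) (mate₂ v)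
  triangleOf v = proj₁ (proj₂ (proj₂ (tri v)))

  mate₁≢mate₂ : ∀ v → mate₁ v ≢ mate₂ v
  mate₁≢mate₂ v = adj⇒≢ (proj₁ (proj₂ (triangleOf v)))

  Mate : Fin n → Fin n → Set
  Mate v w = w ≡ mate₁ v ⊎ w ≡ mate₂ v

  Mate? : ∀ v w → Dec (Mate v w)
  Mate? v w = (w ≟ mate₁ v) ⊎-dec (w ≟ mate₂ v)

  mate⇒adj : ∀ {v w} → Mate v w → Adj G v w
  mate⇒adj {v} (inj₁ refl) = proj₁ (triangleOf v)
  mate⇒adj {v} (inj₂ refl) = proj₂ (proj₂ (triangleOf v))

  mate⇒≢ : ∀ {v w} → Mate v w → v ≢ w
  mate⇒≢ m = adj⇒≢ (mate⇒adj m)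

  triangle⇒mates : ∀ {v x y} → Triangle G v x y → Mate v x × Mate v y
  triangle⇒mates {v} {x} {y} t with proj₂ (proj₂ (proj₂ (tri v))) x y t
  ... | inj₁ (x≡₁ , y≡₂) = inj₁ x≡₁ , inj₂ y≡₂
  ... | inj₂ (x≡₂ , y≡₁) = inj₂ x≡₂ , inj₁ y≡₁

  mateCases : ∀ {v x y w} → Mate v x → Mate v y → x ≢ y → Mate v w → w ≡ x ⊎ w ≡ y
  mateCases (inj₁ refl) (inj₁ refl) x≢y _ = ⊥-elim (x≢y refl)
  mateCases (inj₂ refl) (inj₂ refl) x≢y _ = ⊥-elim (x≢y refl)
  mateCases (inj₁ refl) (inj₂ refl) _ (inj₁ w≡x) = inj₁ w≡x
  mateCases (inj₁ refl) (inj₂ refl) _ (inj₂ w≡y) = inj₂ w≡y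
  mateCases (inj₂ refl) (inj₁ refl) _ (inj₁ w≡y) = inj₂ w≡y
  mateCases (inj₂ refl) (inj₁ refl) _ (inj₂ w≡x) = inj₁ w≡x

  matesAdjacent : ∀ {v x y} → Mate v x → Mate v y → x ≢ y → Adj G x y
  matesAdjacent {v} m₁ m₂ x≢y with mateCases (inj₁ refl) (inj₂ refl) (mate₁≢mate₂ v) m₁
                                  | mateCases (inj₁ refl) (inj₂ refl) (mate₁≢mate₂ v) m₂
  ... | inj₁ refl | inj₁ refl = ⊥-elim (x≢y refl)
  ... | inj₁ refl | inj₂ refl = proj₁ (proj₂ (triangleOf v))
  ... | inj₂ refl | inj₁ refl = adj-sym (proj₁ (proj₂ (triangleOf v)))
  ... | inj₂ refl | inj₂ refl = ⊥-elim (x≢y refl)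

  third : Fin n → Fin n → Fin n
  third v w with w ≟ mate₁ v
  ... | yes _ = mate₂ v
  ... | no _ = mate₁ v

  third-mate : ∀ {v w} → Mate v w → Mate v (third v w) × third v w ≢ w
  third-mate {v} {w} m with w ≟ mate₁ v
  ... | yes refl = inj₂ refl , ≢-sym (mate₁≢mate₂ v)
  ... | no w≢₁ = inj₁ refl , ≢-sym w≢₁

  third-unique : ∀ {v w u} → Mate v w → Mate v u → u ≢ w → u ≡ third v w
  third-unique m mu u≢w with mateCases m (proj₁ (third-mate m)) (≢-sym (proj₂ (third-mate m))) mu
  ... | inj₁ u≡w = ⊥-elim (u≢w u≡w)
  ... | inj₂ u≡t = u≡t

  mate-sym : ∀ {v w} → Mate v w → Mate w v
  mate-sym m = proj₁ (triangle⇒mates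
    (adj-sym (mate⇒adj m) , mate⇒adj (proj₁ (third-mate m)) ,
     matesAdjacent m (proj₁ (third-mate m)) (≢-sym (proj₂ (third-mate m)))))

  matesMate : ∀ {v x y} → Mate v x → Mate v y → x ≢ y → Mate x y
  matesMate mx my x≢y =
    proj₂ (triangle⇒mates (adj-sym (mate⇒adj mx) , mate⇒adj my , matesAdjacent mx my x≢y))

  SameTri : Fin n → Fin n → Set
  SameTri v u = u ≡ v ⊎ Mate v u

  SameTri? : ∀ v u → Dec (SameTri v u)
  SameTri? v u = (u ≟ v) ⊎-dec Mate? v u

  sameTri-sym : ∀ {v u} → SameTri v u → SameTri u v
  sameTri-sym (inj₁ refl) = inj₁ refl
  sameTri-sym (inj₂ m) = inj₂ (mate-sym m)

  sameTri-trans : ∀ {v u w} → SameTri v u → SameTri u w → SameTri v w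
  sameTri-trans (inj₁ refl) uw = uw
  sameTri-trans vu (inj₁ refl) = vu
  sameTri-trans {v} {u} {w} (inj₂ vu) (inj₂ uw) with w ≟ v
  ... | yes w≡v = inj₁ w≡v
  ... | no w≢v = inj₂ (matesMate (mate-sym vu) uw (≢-sym w≢v))

  private
    neighbours : Fin n → List (Fin n)
    neighbours v = filter (λ w → T? (Graph.adj G v w)) (allFin n)

    neighbour∈ : ∀ {v w} → Adj G v w → w ∈ neighbours v
    neighbour∈ {v} {w} = ∈-filter⁺ (λ w → T? (Graph.adj G v w)) (∈-allFin w)

    outsideEntry : ∀ v → Σ (Fin n) λ o → o ∈ neighbours v × o ≢ mate₁ v × o ≢ mate₂ v ×
                     (∀ {w} → w ∈ neighbours v → OneOf (mate₁ v) (mate₂ v) o w)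
    outsideEntry v =
      thirdEntry (neighbours v) (cubic v)
        (Unique.filter⁺ (λ w → T? (Graph.adj G v w)) (Unique.allFin⁺ n))
        (neighbour∈ (proj₁ (triangleOf v))) (neighbour∈ (proj₂ (proj₂ (triangleOf v))))
        (mate₁≢mate₂ v)

  out : Fin n → Fin n
  out v = proj₁ (outsideEntry v)

  out-adj : ∀ v → Adj G v (out v)
  out-adj v = proj₂ (∈-filter⁻ (λ w → T? (Graph.adj G v w)) {xs = allFin n}
                                (proj₁ (proj₂ (outsideEntry v))))

  neighbourCases : ∀ {v w} → Adj G v w → Mate v w ⊎ w ≡ out v
  neighbourCases {v} vw with proj₂ (proj₂ (proj₂ (proj₂ (outsideEntry v)))) (neighbour∈ vw)
  ... | inj₁ w≡₁ = inj₁ (inj₁ w≡₁)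
  ... | inj₂ (inj₁ w≡₂) = inj₁ (inj₂ w≡₂)
  ... | inj₂ (inj₂ w≡o) = inj₂ w≡o

  out-notMate : ∀ {v} → ¬ Mate v (out v)
  out-notMate {v} (inj₁ o≡₁) = proj₁ (proj₂ (proj₂ (outsideEntry v))) o≡₁
  out-notMate {v} (inj₂ o≡₂) = proj₁ (proj₂ (proj₂ (proj₂ (outsideEntry v)))) o≡₂

  out-leaves : ∀ {v} → ¬ SameTri v (out v)
  out-leaves {v} (inj₁ o≡v) = adj⇒≢ (out-adj v) (≡.sym o≡v)
  out-leaves (inj₂ m) = out-notMate m

  out-involutive : ∀ v → out (out v) ≡ v
  out-involutive v with neighbourCases (adj-sym (out-adj v))
  ... | inj₁ m = ⊥-elim (out-notMate (mate-sym m))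
  ... | inj₂ v≡oo = ≡.sym v≡oo

  -- L = (p₁ , q₁) ∷ … ∷ (pₖ , qₖ) ∷ [] describes a closed cycle of distinct
  -- triangles: the i-th is entered at pᵢ and left at its mate qᵢ, along the
  -- edge qᵢ – out qᵢ into the next one.
  record TriangleCycle (L : List (Fin n × Fin n)) : Set where
    field
      exitIsMate : ∀ {p q} → (p , q) ∈ L → Mate p q
      next : ∀ {p q} → (p , q) ∈ L → ∃[ q′ ] (out q , q′) ∈ L
      previous : ∀ {p q} → (p , q) ∈ L → ∃[ p′ ] (p′ , out p) ∈ L
      onePerTriangle : ∀ {p q p′ q′} → (p , q) ∈ L → (p′ , q′) ∈ L → SameTri p p′ →
                       p ≡ p′ × q ≡ q′

-- Chains of triangles ending in the triangle of a fixed vertex z, obtained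
-- from walks avoiding z by loop erasure.  Closing such a chain with the pair
-- (e , z) gives a cycle of triangles through z's triangle, left at z.
module TriangleChains {n : ℕ} (G : Graph n) (cubic : Cubic G)
                      (tri : ∀ v → InExactlyOneTriangle G v) (z : Fin n) where

  open TriangleStructure G cubic tri

  Pairs : Set
  Pairs = List (Fin n × Fin n)

  -- Chain s S: from s, pass through the triangles listed in S, each entered
  -- at p and left at q ∈ triangle(p) towards out q, until a mate of z.
  data Chain : Fin n → Pairs → Set where
    arrive : ∀ {s} → Mate z s → Chain s []
    pass : ∀ {s q S} → ¬ SameTri z s → SameTri s q → Chain (out q) S → Chain s ((s , q) ∷ S)

  Apart : Fin n × Fin n → Fin n × Fin n → Set
  Apart e e′ = ¬ SameTri (proj₁ e) (proj₁ e′)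

  SimpleChain : Fin n → Set
  SimpleChain s = Σ Pairs λ S → Chain s S × AllPairs Apart S

  end : ∀ {s S} → Chain s S → Fin n
  end (arrive {s} _) = s
  end (pass _ _ c) = end c

  end-mate : ∀ {s S} (c : Chain s S) → Mate z (end c)
  end-mate (arrive z~s) = z~s
  end-mate (pass _ _ c) = end-mate c

  entry-outside : ∀ {s S p q} → Chain s S → (p , q) ∈ S → ¬ SameTri z p
  entry-outside (pass ¬zs _ _) (here refl) = ¬zs
  entry-outside (pass _ _ c) (there pq∈) = entry-outside c pq∈

  -- Shortcut: when s lies in a triangle the chain visits later, restart the
  -- chain at s from that triangle's exit.
  shortcut : ∀ {s u S} → ¬ SameTri z s → Chain u S → AllPairs Apart S →
             Any (λ e → SameTri (proj₁ e) s) S → SimpleChain s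
  shortcut ¬zs (pass {q = q} {S = S} _ pq c) (apart ∷ apartS) (here ps) =
    (_ , q) ∷ S , pass ¬zs (sameTri-trans (sameTri-sym ps) pq) c ,
    All.map (λ ¬pp′ sp′ → ¬pp′ (sameTri-trans ps sp′)) apart ∷ apartS
  shortcut ¬zs (pass _ _ c) (_ ∷ apartS) (there visited) = shortcut ¬zs c apartS visited

  -- Loop erasure of a walk from s to a mate of z avoiding z.
  erase : ∀ {s x} → Mate z x → WalkAvoid G (λ w → w ≡ z) s x → SimpleChain s
  erase z~x (here _) = [] , arrive z~x , []
  erase {s} z~x (step {v = v} s≢z sv W) with SameTri? z s
  ... | yes (inj₁ s≡z) = ⊥-elim (s≢z s≡z)
  ... | yes (inj₂ z~s) = [] , arrive z~s , []
  ... | no ¬zs with erase z~x W | neighbourCases sv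
  ...   | S , c , apart | inj₁ s~v = enterEarlier c apart
    where
    -- v lies in s's triangle: the first triangle is entered at s instead.
    enterEarlier : ∀ {S} → Chain v S → AllPairs Apart S → SimpleChain s
    enterEarlier (arrive z~v) _ = ⊥-elim (¬zs (sameTri-trans (inj₂ z~v) (inj₂ (mate-sym s~v))))
    enterEarlier (pass {q = q} {S = S′} _ vq c′) (apart′ ∷ apartS′) =
      (s , q) ∷ S′ , pass ¬zs (sameTri-trans (inj₂ s~v) vq) c′ ,
      All.map (λ ¬vp sp → ¬vp (sameTri-trans (inj₂ (mate-sym s~v)) sp)) apart′ ∷ apartS′
  ...   | S , c , apart | inj₂ v≡out with Any.any? (λ e → SameTri? (proj₁ e) s) S
  ...     | yes visited = shortcut ¬zs c apart visited
  ...     | no unvisited =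
    (s , s) ∷ S , pass ¬zs (inj₁ refl) (subst (λ w → Chain w S) v≡out c) ,
    All.map (λ ¬ps sp → ¬ps (sameTri-sym sp)) (¬Any⇒All¬ S unvisited) ∷ apart

  successor : ∀ {s S p q} (c : Chain s S) → (p , q) ∈ S →
              (∃[ q′ ] (out q , q′) ∈ S) ⊎ out q ≡ end c
  successor (pass _ _ (arrive _)) (here refl) = inj₂ refl
  successor (pass _ _ (pass _ _ _)) (here refl) = inj₁ (_ , there (here refl))
  successor (pass _ _ c) (there pq∈) =
    Sum.map (λ { (q′ , m) → q′ , there m }) id (successor c pq∈)

  predecessor : ∀ {s S p q} → Chain s S → (p , q) ∈ S → p ≡ s ⊎ ∃[ p′ ] (p′ , out p) ∈ S
  predecessor (pass _ _ _) (here refl) = inj₁ refl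
  predecessor {s} (pass {q = q} _ _ c) (there pq∈) with predecessor c pq∈
  ... | inj₁ refl = inj₂ (s , here (cong (s ,_) (out-involutive q)))
  ... | inj₂ (p′ , m) = inj₂ (p′ , there m)

  lastExit : ∀ {s q S} (c : Chain (out q) S) → ∃[ p′ ] (p′ , out (end c)) ∈ ((s , q) ∷ S)
  lastExit {s} {q} (arrive _) = s , here (cong (s ,_) (out-involutive q))
  lastExit (pass _ _ c) with lastExit c
  ... | p′ , m = p′ , there m

  noReturn : ∀ {t u S} → Chain u S → SameTri t u → ¬ SameTri z t →
             All (λ e → ¬ SameTri t (proj₁ e)) S → ⊥
  noReturn (arrive z~u) tu ¬zt _ = ¬zt (sameTri-trans (inj₂ z~u) (sameTri-sym tu))
  noReturn (pass _ _ _) tu _ (¬tu ∷ _) = ¬tu tu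

  noChainFromZ : ∀ {S} → Chain z S → ⊥
  noChainFromZ (arrive z~z) = mate⇒≢ z~z refl
  noChainFromZ (pass ¬zz _ _) = ¬zz (inj₁ refl)

  -- In a simple chain every triangle after the first is left at a vertex
  -- other than its entry: otherwise the chain would step straight back.
  laterExitsAreMates : ∀ {s q S} → Chain s ((s , q) ∷ S) → AllPairs Apart ((s , q) ∷ S) →
                       ∀ {p′ q′} → (p′ , q′) ∈ S → Mate p′ q′
  laterExitsAreMates (pass _ _ (pass _ (inj₂ p~q) _)) _ (here refl) = p~q
  laterExitsAreMates {q = q} (pass ¬zs sq (pass _ (inj₁ refl) c)) ((_ ∷ apart) ∷ _) (here refl) =
    ⊥-elim (noReturn (subst (λ w → Chain w _) (out-involutive q) c) sq ¬zs apart)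
  laterExitsAreMates (pass _ _ c@(pass _ _ _)) (_ ∷ apartS) (there pq∈) =
    laterExitsAreMates c apartS pq∈

  module _ {S : Pairs} (c : Chain (out z) S) (apart : AllPairs Apart S) where

    Closed : Pairs
    Closed = (end c , z) ∷ S

    closed-exitIsMate : ∀ {p q} → (p , q) ∈ Closed → Mate p q
    closed-exitIsMate (here refl) = mate-sym (end-mate c)
    closed-exitIsMate (there pq∈) = exitsOf c apart pq∈
      where
      exitsOf : ∀ {S} → Chain (out z) S → AllPairs Apart S → ∀ {p q} → (p , q) ∈ S → Mate p q
      exitsOf (pass _ (inj₂ oz~q) _) _ (here refl) = oz~q
      exitsOf (pass _ (inj₁ refl) c′) _ (here refl) =
        ⊥-elim (noChainFromZ (subst (λ w → Chain w _) (out-involutive z) c′))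
      exitsOf c′@(pass _ _ _) apart′ (there pq∈) = laterExitsAreMates c′ apart′ pq∈

    closed-next : ∀ {p q} → (p , q) ∈ Closed → ∃[ q′ ] (out q , q′) ∈ Closed
    closed-next (here refl) = first c
      where
      first : ∀ {S} → Chain (out z) S → ∃[ q′ ] (out z , q′) ∈ ((end c , z) ∷ S)
      first (arrive z~oz) = ⊥-elim (out-notMate z~oz)
      first (pass {q = q₀} _ _ _) = q₀ , there (here refl)
    closed-next (there pq∈) with successor c pq∈
    ... | inj₁ (q′ , m) = q′ , there m
    ... | inj₂ out≡end = z , here (cong (_, z) out≡end)

    closed-previous : ∀ {p q} → (p , q) ∈ Closed → ∃[ p′ ] (p′ , out p) ∈ Closed
    closed-previous (here refl) = last c
      where
      last : ∀ {S} (c′ : Chain (out z) S) → ∃[ p′ ] (p′ , out (end c′)) ∈ ((end c , z) ∷ S)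
      last (arrive z~oz) = ⊥-elim (out-notMate z~oz)
      last (pass _ _ c′) with lastExit c′
      ... | p′ , m = p′ , there m
    closed-previous (there pq∈) with predecessor c pq∈
    ... | inj₁ refl = end c , here (cong (end c ,_) (out-involutive z))
    ... | inj₂ (p′ , m) = p′ , there m

    closed-onePerTriangle : ∀ {p q p′ q′} → (p , q) ∈ Closed → (p′ , q′) ∈ Closed → SameTri p p′ →
               p ≡ p′ × q ≡ q′
    closed-onePerTriangle (here refl) (here refl) _ = refl , refl
    closed-onePerTriangle (here refl) (there m′) ep′ =
      ⊥-elim (entry-outside c m′ (sameTri-trans (inj₂ (end-mate c)) ep′))
    closed-onePerTriangle (there m) (here refl) pe =
      ⊥-elim (entry-outside c m (sameTri-trans (inj₂ (end-mate c)) (sameTri-sym pe)))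
    closed-onePerTriangle (there m) (there m′) pp′ with allPairs-lookup apart m m′
    ... | inj₁ refl = refl , refl
    ... | inj₂ (inj₁ ¬pp′) = ⊥-elim (¬pp′ pp′)
    ... | inj₂ (inj₂ ¬p′p) = ⊥-elim (¬p′p (sameTri-sym pp′))

    closedCycle : TriangleCycle Closed
    closedCycle = record
      { exitIsMate = closed-exitIsMate
      ; next = closed-next
      ; previous = closed-previous
      ; onePerTriangle = closed-onePerTriangle
      }

  cycleThrough : TwoConnected G → ∃[ e ] ∃[ S ] TriangleCycle ((e , z) ∷ S)
  cycleThrough (_ , _ , avoiding)
    with erase (inj₁ refl) (avoiding z (out z) (mate₁ z) (λ oz≡z → out-leaves (inj₁ oz≡z))
                                     (≢-sym (mate⇒≢ (inj₁ refl))))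
  ... | S , c , apart = end c , S , closedCycle c apart

module ΛConstruction {n : ℕ} (G : Graph n) (cubic : Cubic G)
                     (tri : ∀ v → InExactlyOneTriangle G v)
                     (H : Graph n) (L : List (Fin n × Fin n)) where

  open TriangleStructure G cubic tri

  H-sym : ∀ {u w} → Adj H u w → Adj H w u
  H-sym {u} {w} = subst T (Graph.sym H u w)

  Entry Exit Cyclic : Fin n → Set
  Entry u = Any (λ e → proj₁ e ≡ u) L
  Exit u = Any (λ e → proj₂ e ≡ u) L
  Cyclic u = Any (λ e → SameTri (proj₁ e) u) L

  Entry? : ∀ u → Dec (Entry u)
  Entry? u = Any.any? (λ e → proj₁ e ≟ u) L

  Exit? : ∀ u → Dec (Exit u)
  Exit? u = Any.any? (λ e → proj₂ e ≟ u) L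

  Cyclic? : ∀ u → Dec (Cyclic u)
  Cyclic? u = Any.any? (λ e → SameTri? (proj₁ e) u) L

  cyclic-sameTri : ∀ {x y} → Cyclic x → SameTri x y → Cyclic y
  cyclic-sameTri cx xy = Any.map (λ px → sameTri-trans px xy) cx

  record Compatible : Set where
    field
      triangleEdge : ∀ {x y t} → ¬ Cyclic x → Mate x y → Mate x t → y ≢ t →
                     ¬ Adj H x y → Adj H x t
      entryEdges : ∀ {p q} → (p , q) ∈ L → Adj H p (out p) × Adj H p (third p q)

  -- The edge u w of a non-cyclic triangle is dropped when its opposite corner
  -- t keeps both its edges in H and is the least corner.
  Drops : Fin n → Fin n → Fin n → Set
  Drops t u w = Adj H u t × Adj H w t × t < u × t < w

  Dropped : Fin n → Fin n → Set
  Dropped u w = Drops (third u w) u w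

  CycleEdge : Fin n → Fin n → Set
  CycleEdge u w = (Mate u w × ¬ Exit u × ¬ Exit w × (Entry u ⊎ Entry w))
                ⊎ (w ≡ out u × (Entry u ⊎ Exit u))

  TriangleEdge : Fin n → Fin n → Set
  TriangleEdge u w = Mate u w × ¬ Dropped u w

  -- u proposes the edge u w; the factor keeps the edges proposed by both ends.
  Proposes : Fin n → Fin n → Set
  Proposes u w = Adj H u w × ((Cyclic u × CycleEdge u w) ⊎ (¬ Cyclic u × TriangleEdge u w))

  Proposes? : ∀ u w → Dec (Proposes u w)
  Proposes? u w = T? (Graph.adj H u w) ×-dec
    ((Cyclic? u ×-dec CycleEdge?) ⊎-dec (¬? (Cyclic? u) ×-dec (Mate? u w ×-dec ¬? Dropped?)))
    where
    CycleEdge? : Dec (CycleEdge u w)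
    CycleEdge? = (Mate? u w ×-dec ¬? (Exit? u) ×-dec ¬? (Exit? w) ×-dec (Entry? u ⊎-dec Entry? w))
                 ⊎-dec ((w ≟ out u) ×-dec (Entry? u ⊎-dec Exit? u))
    Dropped? : Dec (Dropped u w)
    Dropped? = T? (Graph.adj H u (third u w)) ×-dec T? (Graph.adj H w (third u w)) ×-dec
               (third u w <? u) ×-dec (third u w <? w)

  proposes-irrefl : ∀ v → ¬ Proposes v v
  proposes-irrefl v (vv , _) = subst T (Graph.irrefl H v) vv

  F : Graph n
  F = symmetricCore Proposes Proposes? proposes-irrefl

  proposal : ∀ {x y} → Adj F x y → Proposes x y
  proposal xy = proj₁ (coreAdj⁻ Proposes Proposes? proposes-irrefl xy)

  agree : ∀ {x y} → Proposes x y → Proposes y x → Adj F x y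
  agree = coreAdj⁺ Proposes Proposes? proposes-irrefl

  F⊆H : Subgraph F H
  F⊆H u w uw = proj₁ (proposal uw)

  cycleEdgeOf : ∀ {x y} → Cyclic x → Adj F x y → CycleEdge x y
  cycleEdgeOf cx xy with proj₂ (proposal xy)
  ... | inj₁ (_ , e) = e
  ... | inj₂ (¬cx , _) = ⊥-elim (¬cx cx)

  mateOf : ∀ {x y} → ¬ Cyclic x → Adj F x y → Mate x y
  mateOf ¬cx xy with proj₂ (proposal xy)
  ... | inj₁ (cx , _) = ⊥-elim (¬cx cx)
  ... | inj₂ (_ , m , _) = m

  module _ (cycle : TriangleCycle L) (compatible : Compatible) where
    open TriangleCycle cycle
    open Compatible compatible

    entryNotExit : ∀ {p q} → (p , q) ∈ L → ¬ Exit p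
    entryNotExit {p} {q} pq∈ e with find e
    ... | _ , m , refl = mate⇒≢ (exitIsMate pq∈) (≡.sym q≡p)
      where
      q≡p : q ≡ p
      q≡p = proj₂ (onePerTriangle pq∈ m (inj₂ (mate-sym (exitIsMate m))))

    thirdNotExit : ∀ {p q} → (p , q) ∈ L → ¬ Exit (third p q)
    thirdNotExit {p} {q} pq∈ e with find e
    ... | _ , m , refl = proj₂ (third-mate (exitIsMate pq∈)) (≡.sym q≡r)
      where
      p~r : Mate p (third p q)
      p~r = proj₁ (third-mate (exitIsMate pq∈))
      q≡r : q ≡ third p q
      q≡r = proj₂ (onePerTriangle pq∈ m (sameTri-trans (inj₂ p~r) (inj₂ (mate-sym (exitIsMate m)))))

    thirdNotEntry : ∀ {p q} → (p , q) ∈ L → ¬ Entry (third p q)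
    thirdNotEntry {p} {q} pq∈ e with find e
    ... | _ , m , refl = mate⇒≢ p~r (proj₁ (onePerTriangle pq∈ m (inj₂ p~r)))
      where
      p~r : Mate p (third p q)
      p~r = proj₁ (third-mate (exitIsMate pq∈))

    cycleBlock : ∀ {p q} → (p , q) ∈ L → ∀ {v} → OneOf (out p) p (third p q) v → ΛBlock F v
    cycleBlock {p} {q} pq∈ v∈ =
      mkΛBlock (out p) p r (λ e → out-leaves (inj₁ e)) (mate⇒≢ p~r)
               (λ e → out-notMate (subst (Mate p) (≡.sym e) p~r)) v∈
               (agree out→p p→out) (agree p→r r→p)
               noChord closed
      where
      r : Fin n
      r = third p q
      p~q : Mate p q
      p~q = exitIsMate pq∈
      p~r : Mate p r
      p~r = proj₁ (third-mate p~q)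
      exit-p : ¬ Exit p
      exit-p = entryNotExit pq∈
      exit-r : ¬ Exit r
      exit-r = thirdNotExit pq∈
      entry-r : ¬ Entry r
      entry-r = thirdNotEntry pq∈
      pred : ∃[ p′ ] (p′ , out p) ∈ L
      pred = previous pq∈

      exit-out : Exit (out p)
      exit-out = lose (proj₂ pred) refl

      cyclic-p : Cyclic p
      cyclic-p = lose pq∈ (inj₁ refl)

      cyclic-r : Cyclic r
      cyclic-r = lose pq∈ (inj₂ p~r)

      cyclic-out : Cyclic (out p)
      cyclic-out = lose (proj₂ pred) (inj₂ (exitIsMate (proj₂ pred)))

      out→p : Proposes (out p) p
      out→p = H-sym (proj₁ (entryEdges pq∈)) ,
              inj₁ (cyclic-out , inj₂ (≡.sym (out-involutive p) , inj₂ exit-out))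

      p→out : Proposes p (out p)
      p→out = proj₁ (entryEdges pq∈) , inj₁ (cyclic-p , inj₂ (refl , inj₁ (lose pq∈ refl)))

      p→r : Proposes p r
      p→r = proj₂ (entryEdges pq∈) ,
            inj₁ (cyclic-p , inj₁ (p~r , exit-p , exit-r , inj₁ (lose pq∈ refl)))

      r→p : Proposes r p
      r→p = H-sym (proj₂ (entryEdges pq∈)) ,
            inj₁ (cyclic-r , inj₁ (mate-sym p~r , exit-r , exit-p , inj₂ (lose pq∈ refl)))

      noChord : ¬ Adj F (out p) r
      noChord e with cycleEdgeOf cyclic-out e
      ... | inj₁ (_ , ¬exit , _) = ¬exit exit-out
      ... | inj₂ (r≡oo , _) = mate⇒≢ p~r (≡.sym (≡.trans r≡oo (out-involutive p)))

      closed : ∀ {x y} → OneOf (out p) p r x → Adj F x y → OneOf (out p) p r y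
      closed (inj₁ refl) xy with cycleEdgeOf cyclic-out xy
      ... | inj₁ (_ , ¬exit , _) = ⊥-elim (¬exit exit-out)
      ... | inj₂ (y≡oo , _) = inj₂ (inj₁ (≡.trans y≡oo (out-involutive p)))
      closed (inj₂ (inj₁ refl)) xy with cycleEdgeOf cyclic-p xy
      ... | inj₁ (p~y , _ , ¬exit-y , _) =
        inj₂ (inj₂ (third-unique p~q p~y (λ y≡q → ¬exit-y (lose pq∈ (≡.sym y≡q)))))
      ... | inj₂ (y≡out , _) = inj₁ y≡out
      closed (inj₂ (inj₂ refl)) xy with cycleEdgeOf cyclic-r xy
      ... | inj₂ (_ , entry-or-exit) = ⊥-elim ([ entry-r , exit-r ]′ entry-or-exit)
      ... | inj₁ (r~y , _ , ¬exit-y , _) with sameTri-trans (inj₂ p~r) (inj₂ r~y)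
      ...   | inj₁ y≡p = inj₂ (inj₁ y≡p)
      ...   | inj₂ p~y = ⊥-elim (mate⇒≢ r~y (≡.sym
                (third-unique p~q p~y (λ y≡q → ¬exit-y (lose pq∈ (≡.sym y≡q))))))

    Centre : Fin n → Fin n → Fin n → Set
    Centre c e₁ e₂ = Adj H c e₁ × Adj H c e₂ × (¬ Adj H e₁ e₂ ⊎ (c < e₁ × c < e₂))

    triangleBlock : ∀ {c e₁ e₂} → ¬ Cyclic c → Mate c e₁ → Mate c e₂ → e₁ ≢ e₂ →
      Centre c e₁ e₂ → ∀ {v} → OneOf e₁ c e₂ v → ΛBlock F v
    triangleBlock {c} {e₁} {e₂} ¬cc c~e₁ c~e₂ e₁≢e₂ (c-e₁ , c-e₂ , least) v∈ =
      mkΛBlock e₁ c e₂ (mate⇒≢ e₁~c) (mate⇒≢ c~e₂) e₁≢e₂ v∈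
        (agree e₁→c c→e₁) (agree c→e₂ e₂→c)
        noChord closed
      where
      e₁~c : Mate e₁ c
      e₁~c = mate-sym c~e₁
      e₂~c : Mate e₂ c
      e₂~c = mate-sym c~e₂
      e₁~e₂ : Mate e₁ e₂
      e₁~e₂ = matesMate c~e₁ c~e₂ e₁≢e₂
      e₂~e₁ : Mate e₂ e₁
      e₂~e₁ = mate-sym e₁~e₂
      ¬ce₁ : ¬ Cyclic e₁
      ¬ce₁ ce₁ = ¬cc (cyclic-sameTri ce₁ (inj₂ e₁~c))
      ¬ce₂ : ¬ Cyclic e₂
      ¬ce₂ ce₂ = ¬cc (cyclic-sameTri ce₂ (inj₂ e₂~c))

      notBeaten : ∀ {e} → Adj H e₁ e₂ → e < c → (e ≡ e₁ ⊎ e ≡ e₂) → ⊥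
      notBeaten e₁-e₂ e<c e∈ =
        [ (λ ¬e₁e₂ → ¬e₁e₂ e₁-e₂)
        , (λ { (c<e₁ , c<e₂) →
                 [ (λ { refl → <-asym e<c c<e₁ }) , (λ { refl → <-asym e<c c<e₂ }) ]′ e∈ })
        ]′ least

      propose : ∀ {x y t} → ¬ Cyclic x → Adj H x y → Mate x y → Mate x t → t ≢ y →
                ¬ Drops t x y → Proposes x y
      propose ¬cx x-y x~y x~t t≢y ¬drops =
        x-y , inj₂ (¬cx , x~y , subst (λ t → ¬ Drops t _ _) (third-unique x~y x~t t≢y) ¬drops)

      e₁→c : Proposes e₁ c
      e₁→c = propose ¬ce₁ (H-sym c-e₁) e₁~c e₁~e₂ (≢-sym (mate⇒≢ c~e₂))
        λ { (e₁-e₂ , _ , _ , e₂<c) → notBeaten e₁-e₂ e₂<c (inj₂ refl) }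

      c→e₁ : Proposes c e₁
      c→e₁ = propose ¬cc c-e₁ c~e₁ c~e₂ (≢-sym e₁≢e₂)
        λ { (_ , e₁-e₂ , e₂<c , _) → notBeaten e₁-e₂ e₂<c (inj₂ refl) }

      c→e₂ : Proposes c e₂
      c→e₂ = propose ¬cc c-e₂ c~e₂ c~e₁ e₁≢e₂
        λ { (_ , e₂-e₁ , e₁<c , _) → notBeaten (H-sym e₂-e₁) e₁<c (inj₁ refl) }

      e₂→c : Proposes e₂ c
      e₂→c = propose ¬ce₂ (H-sym c-e₂) e₂~c e₂~e₁ (≢-sym (mate⇒≢ c~e₁))
        λ { (e₂-e₁ , _ , _ , e₁<c) → notBeaten (H-sym e₂-e₁) e₁<c (inj₁ refl) }

      noChord : ¬ Adj F e₁ e₂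
      noChord e with proposal e
      ... | e₁-e₂ , inj₁ (ce₁ , _) = ¬ce₁ ce₁
      ... | e₁-e₂ , inj₂ (_ , _ , ¬dropped) =
        [ (λ ¬e₁e₂ → ¬e₁e₂ e₁-e₂)
        , (λ { (c<e₁ , c<e₂) → ¬dropped
                 (subst (λ t → Drops t e₁ e₂) (third-unique e₁~e₂ e₁~c (mate⇒≢ c~e₂))
                        (H-sym c-e₁ , H-sym c-e₂ , c<e₁ , c<e₂)) }) ]′ least

      inTriangle : ∀ {x} → OneOf e₁ c e₂ x → SameTri c x
      inTriangle (inj₁ refl) = inj₂ c~e₁
      inTriangle (inj₂ (inj₁ refl)) = inj₁ refl
      inTriangle (inj₂ (inj₂ refl)) = inj₂ c~e₂

      fromTriangle : ∀ {y} → SameTri c y → OneOf e₁ c e₂ y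
      fromTriangle (inj₁ y≡c) = inj₂ (inj₁ y≡c)
      fromTriangle (inj₂ c~y) =
        [ inj₁ , (λ y≡e₂ → inj₂ (inj₂ y≡e₂)) ]′ (mateCases c~e₁ c~e₂ e₁≢e₂ c~y)

      closed : ∀ {x y} → OneOf e₁ c e₂ x → Adj F x y → OneOf e₁ c e₂ y
      closed {x} x∈ xy = fromTriangle (sameTri-trans (inTriangle x∈) (inj₂ (mateOf ¬cx xy)))
        where
        ¬cx : ¬ Cyclic x
        ¬cx cx = ¬cc (cyclic-sameTri cx (sameTri-sym (inTriangle x∈)))

    nonCyclicBlock : ∀ v → ¬ Cyclic v → ΛBlock F v
    nonCyclicBlock v ¬cv =
      centred (T? (Graph.adj H a b)) (T? (Graph.adj H v b)) (T? (Graph.adj H v a))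
      where
      a b : Fin n
      a = mate₁ v
      b = mate₂ v
      v~a : Mate v a
      v~a = inj₁ refl
      v~b : Mate v b
      v~b = inj₂ refl
      a≢b : a ≢ b
      a≢b = mate₁≢mate₂ v
      a~v : Mate a v
      a~v = mate-sym v~a
      b~v : Mate b v
      b~v = mate-sym v~b
      a~b : Mate a b
      a~b = matesMate v~a v~b a≢b
      b~a : Mate b a
      b~a = mate-sym a~b
      ¬ca : ¬ Cyclic a
      ¬ca ca = ¬cv (cyclic-sameTri ca (inj₂ a~v))
      ¬cb : ¬ Cyclic b
      ¬cb cb = ¬cv (cyclic-sameTri cb (inj₂ b~v))

      centred : Dec (Adj H a b) → Dec (Adj H v b) → Dec (Adj H v a) → ΛBlock F v
      centred (no ¬ab) _ _ =
        triangleBlock ¬cv v~a v~b a≢b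
          ( H-sym (triangleEdge ¬ca a~b a~v (≢-sym (mate⇒≢ v~b)) ¬ab)
          , H-sym (triangleEdge ¬cb b~a b~v (≢-sym (mate⇒≢ v~a)) (λ ba → ¬ab (H-sym ba)))
          , inj₁ ¬ab)
          (inj₂ (inj₁ refl))
      centred (yes ab) (no ¬vb) _ =
        triangleBlock ¬ca a~v a~b (mate⇒≢ v~b)
          (H-sym (triangleEdge ¬cv v~b v~a (≢-sym a≢b) ¬vb) , ab , inj₁ ¬vb) (inj₁ refl)
      centred (yes ab) (yes vb) (no ¬va) =
        triangleBlock ¬cb b~v b~a (mate⇒≢ v~a) (H-sym vb , H-sym ab , inj₁ ¬va) (inj₁ refl)
      centred (yes ab) (yes vb) (yes va) =
        [ (λ v-least → triangleBlock ¬cv v~a v~b a≢b (va , vb , inj₂ v-least) (inj₂ (inj₁ refl)))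
        , [ (λ a-least → triangleBlock ¬ca a~v a~b (mate⇒≢ v~b)
                                         (H-sym va , ab , inj₂ a-least) (inj₁ refl))
          , (λ b-least → triangleBlock ¬cb b~v b~a (mate⇒≢ v~a)
                                         (H-sym vb , H-sym ab , inj₂ b-least) (inj₁ refl))
          ]′ ]′ (leastOfThree (mate⇒≢ v~a) a≢b (mate⇒≢ v~b))

    -- A cyclic vertex is the entry p, the third corner, or the exit q of some
    -- pair; an exit is the left end of the block of the next pair.
    block : ∀ v → ΛBlock F v
    block v with Cyclic? v
    ... | no ¬cv = nonCyclicBlock v ¬cv
    ... | yes cv with find cv
    ...   | _ , pq∈ , inj₁ refl = cycleBlock pq∈ (inj₂ (inj₁ refl))
    ...   | (_ , q) , pq∈ , inj₂ p~v with v ≟ q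
    ...     | no v≢q = cycleBlock pq∈ (inj₂ (inj₂ (third-unique (exitIsMate pq∈) p~v v≢q)))
    ...     | yes refl = cycleBlock (proj₂ (next pq∈)) (inj₁ (≡.sym (out-involutive v)))

    ΛFactorFromCycle : ΛFactor H
    ΛFactorFromCycle = ΛFactorFromBlocks H F F⊆H block

module TwoDeletedEdges {n : ℕ} (G : Graph n) (cubic : Cubic G)
                       (tri : ∀ v → InExactlyOneTriangle G v) (a b c d : Fin n) where

  open TriangleStructure G cubic tri

  H : Graph n
  H = deleteTwo G a b c d

  missing : ∀ {u w} → Adj G u w → ¬ Adj H u w → SameEdge u w a b ⊎ SameEdge u w c d
  missing {u} {w} uw ¬uw with isEdge a b u w in ab | isEdge c d u w in cd
  ... | Bool.true | _ = inj₁ (isEdge⁻ (≡.subst T (≡.sym ab) _))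
  ... | Bool.false | Bool.true = inj₂ (isEdge⁻ (≡.subst T (≡.sym cd) _))
  ... | Bool.false | Bool.false = ⊥-elim (¬uw (Equivalence.from (T-∧ {Graph.adj G u w}) (uw , _)))

  TriangleLosesTwo : Set
  TriangleLosesTwo =
    ∃[ z ] ∃[ y ] ∃[ t ] Mate z y × Mate z t × SameEdge z y a b × SameEdge z t c d

  triangleLosesTwo? : Dec TriangleLosesTwo
  triangleLosesTwo? = any? λ z → any? λ y → any? λ t →
    Mate? z y ×-dec Mate? z t ×-dec sameEdge? z y a b ×-dec sameEdge? z t c d
    where
    sameEdge? : ∀ u w x y → Dec (SameEdge u w x y)
    sameEdge? u w x y = ((u ≟ x) ×-dec (w ≟ y)) ⊎-dec ((u ≟ y) ×-dec (w ≟ x))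

  open ΛConstruction G cubic tri H

  factorFromTriangles : ¬ TriangleLosesTwo → ΛFactor H
  factorFromTriangles ¬losesTwo = ΛFactorFromCycle [] noCycle compatible
    where
    noCycle : TriangleCycle []
    noCycle = record { exitIsMate = λ () ; next = λ () ; previous = λ () ; onePerTriangle = λ () }

    atMostOneLost : ∀ {x y t} → ¬ Cyclic [] x → Mate x y → Mate x t → y ≢ t →
                    ¬ Adj H x y → Adj H x t
    atMostOneLost {x} {y} {t} _ x~y x~t y≢t ¬xy with T? (Graph.adj H x t)
    ... | yes xt = xt
    ... | no ¬xt with missing (mate⇒adj x~y) ¬xy | missing (mate⇒adj x~t) ¬xt
    ...   | inj₁ xy-ab | inj₁ xt-ab = ⊥-elim (y≢t (sameEdge-other (mate⇒≢ x~y) xy-ab xt-ab))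
    ...   | inj₂ xy-cd | inj₂ xt-cd = ⊥-elim (y≢t (sameEdge-other (mate⇒≢ x~y) xy-cd xt-cd))
    ...   | inj₁ xy-ab | inj₂ xt-cd = ⊥-elim (¬losesTwo (x , y , t , x~y , x~t , xy-ab , xt-cd))
    ...   | inj₂ xy-cd | inj₁ xt-ab = ⊥-elim (¬losesTwo (x , t , y , x~t , x~y , xt-ab , xy-cd))

    compatible : Compatible []
    compatible = record { triangleEdge = atMostOneLost ; entryEdges = λ () }

  -- If the triangle of z loses its two edges at z, a cycle of triangles
  -- leaving that triangle at z is compatible with H: every missing edge joins
  -- z to a mate of z, so it lies in a cyclic triangle and avoids the entry
  -- edges of the cycle.
  factorFromCycle : ∀ {z y t e S} → Mate z y → Mate z t → SameEdge z y a b → SameEdge z t c d →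
                    TriangleCycle ((e , z) ∷ S) → ΛFactor H
  factorFromCycle {z} {y} {t} {e} {S} z~y z~t zy-ab zt-cd cycle =
    ΛFactorFromCycle ((e , z) ∷ S) cycle compatible
    where
    open TriangleCycle cycle

    e~z : Mate e z
    e~z = exitIsMate (here refl)

    AtZ : Fin n → Fin n → Set
    AtZ u w = (u ≡ z ⊎ w ≡ z) × SameTri z u × SameTri z w

    atZ : ∀ {u w} → SameEdge u w z y ⊎ SameEdge u w z t → AtZ u w
    atZ (inj₁ (inj₁ (refl , refl))) = inj₁ refl , inj₁ refl , inj₂ z~y
    atZ (inj₁ (inj₂ (refl , refl))) = inj₂ refl , inj₂ z~y , inj₁ refl
    atZ (inj₂ (inj₁ (refl , refl))) = inj₁ refl , inj₁ refl , inj₂ z~t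
    atZ (inj₂ (inj₂ (refl , refl))) = inj₂ refl , inj₂ z~t , inj₁ refl

    missingAtZ : ∀ {u w} → Adj G u w → ¬ Adj H u w → AtZ u w
    missingAtZ uw ¬uw =
      atZ (Sum.map (λ uw-ab → sameEdge-trans uw-ab zy-ab) (λ uw-cd → sameEdge-trans uw-cd zt-cd)
                   (missing uw ¬uw))

    survives : ∀ {u w} → Adj G u w → ¬ AtZ u w → Adj H u w
    survives {u} {w} uw ¬atZ with T? (Graph.adj H u w)
    ... | yes uw′ = uw′
    ... | no ¬uw = ⊥-elim (¬atZ (missingAtZ uw ¬uw))

    -- The only pair in z's triangle is (e , z), whose entry edges avoid z.
    entryEdges : ∀ {p q} → (p , q) ∈ ((e , z) ∷ S) → Adj H p (out p) × Adj H p (third p q)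
    entryEdges {p} {q} pq∈ =
      survives (out-adj p) (λ { (_ , zp , zo) → out-leaves (sameTri-trans (sameTri-sym zp) zo) }) ,
      survives (mate⇒adj (proj₁ (third-mate (exitIsMate pq∈)))) avoidsZ
      where
      avoidsZ : ¬ AtZ p (third p q)
      avoidsZ (touches , zp , _)
        with onePerTriangle pq∈ (here refl) (sameTri-trans (sameTri-sym zp) (inj₂ (mate-sym e~z)))
      ... | refl , refl = [ mate⇒≢ e~z , proj₂ (third-mate e~z) ]′ touches

    triangleEdge : ∀ {x y′ t′} → ¬ Cyclic ((e , z) ∷ S) x → Mate x y′ → Mate x t′ → y′ ≢ t′ →
                   ¬ Adj H x y′ → Adj H x t′
    triangleEdge ¬cx x~y′ _ _ ¬xy′ =
      ⊥-elim (¬cx (here (sameTri-trans (inj₂ e~z)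
                                       (proj₁ (proj₂ (missingAtZ (mate⇒adj x~y′) ¬xy′))))))

    compatible : Compatible ((e , z) ∷ S)
    compatible = record { triangleEdge = triangleEdge ; entryEdges = entryEdges }

mainTheorem14 : ∀ {n : ℕ} (G : Graph n) → TwoConnected G → Cubic G →
    (∀ v → InExactlyOneTriangle G v) →
    (a b c d : Fin n) → Adj G a b → Adj G c d →
    ¬ ((a ≡ c × b ≡ d) ⊎ (a ≡ d × b ≡ c)) →
    ΛFactor (deleteTwo G a b c d)
mainTheorem14 G twoConnected cubic tri a b c d _ _ _ = byCases triangleLosesTwo?
  where
  open TwoDeletedEdges G cubic tri a b c d

  byCases : Dec TriangleLosesTwo → ΛFactor H
  byCases (no ¬losesTwo) = factorFromTriangles ¬losesTwo
  byCases (yes (z , y , t , z~y , z~t , zy-ab , zt-cd))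
    with TriangleChains.cycleThrough G cubic tri z twoConnected
  ... | e , S , cycle = factorFromCycle z~y z~t zy-ab zt-cd cycle
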